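{- The inference relation is sound: ${\vdash}\subseteq{\vDash}$, i.e. for every set $\Gamma$ of statements and every statement $X$, if $\Gamma\vdash X$ then $\Gamma\vDash X$.
   Context: Set-theoretic conventions: for sets $R,s$, $\mathrm{dom}(R)=\{d\mid\exists r\,\langle r,d\rangle\in R\}$, $R(s)=\bigcup\{r\mid\langle r,s\rangle\in R\}$; a function $F$ is a set of pairs $\langle F(d),d\rangle$; $Y^X$ is the set of functions from $X$ to $Y$; for a function $\phi$, $\prod\phi$ is the set of functions $f$ on $\mathrm{dom}(\phi)$ with $f(d)\in\phi(d)$. Terms: constants $\mathsf{C}$, variables $\mathsf{V}$; $\mathsf{T}$ is the smallest set of strings containing $\mathsf{C}\cup\mathsf{V}$ and $\beta RS$ (written $RS$) and $\lambda xRS$. Free variables: $\mathsf{F}(a)=\emptyset$, $\mathsf{F}(x)=\{x\}$, $\mathsf{F}(RS)=\mathsf{F}(R)\cup\mathsf{F}(S)$, $\mathsf{F}(\lambda xRS)=\mathsf{F}(R)\cup(\mathsf{F}(S)\setminus\{x\})$. Among the constants are pairwise distinct sorts $\mathsf{u}_n$ and operators $\mathsf{p}_m^n$ ($m,n\in\omega$); $\pi_m^nxQP$ denotes $\mathsf{p}_m^nQ(\lambda xQP)$. Interpretations: any assignment of sets to variables and to constants other than the $\mathsf{p}_m^n$ extends uniquely to $\llbracket\cdot\rrbracket$ on $\mathsf{T}$ with $\llbracket\mathsf{p}_m^n\rrbracket$ the function on $\llbracket\mathsf{u}_m\rrbracket$ sending $D$ to the function on $\llbracket\mathsf{u}_n\rrbracket^D$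 sending $\phi$ to $\prod\phi$; $\llbracket RS\rrbracket=\llbracket R\rrbracket(\llbracket S\rrbracket)$; $\llbracket\lambda xRS\rrbracket=\{\langle\llbracket S\rrbracket_{\langle r,x\rangle},r\rangle\mid r\in\llbracket R\rrbracket\}$ ($\llbracket\cdot\rrbracket_{\langle r,x\rangle}$: assignment changed to $r$ at $x$; $\llbracket\cdot\rrbracket_\psi$: changed to agree with a function $\psi$ from variables to sets). Well-formedness: atomic terms are well-formed; $FS$ is well-formed iff $F,S$ are, $\llbracket F\rrbracket$ is a function and $\llbracket S\rrbracket\in\mathrm{dom}\llbracket F\rrbracket$; $\lambda xRS$ is well-formed iff $R$ is and $S$ is under $\llbracket\cdot\rrbracket_{\langle r,x\rangle}$ for all $r\in\llbracket R\rrbracket$. Statements: typing $(S:P)$, reduction $R\twoheadrightarrow C$, sub-reduction $R\triangleright C$ ($R,C,S,P\in\mathsf{T}$). An interpretation satisfies $(S:P)$ iff $S,P$ are well-formed and $\llbracket S\rrbracket\in\llbracket P\rrbracket$; it satisfies $R\twoheadrightarrow C$ (resp. $R\triangleright C$) iff for every function $\psi$ from variables to sets, whenever $R$ is well-formed w.r.t. $\llbracket\cdot\rrbracket_\psi$, so is $C$ and $\llbracket R\rrbracket_\psi=\llbracket C\rrbracket_\psi$ (resp. $\subseteq$). $\Gamma\vDash X$ means every interpretation satisfying all statements of $\Gamma$ satisfies $X$. $\mathsf{F}(\Gamma)$ is the union of $\mathsf{F}(S)\cup\mathsf{F}(P)$ over typing statements $(S:P)\in\Gamma$. For a relation $\Vdash$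 between sets of statements and statements, $\Gamma\Vdash\Delta$ means $\Gamma\Vdash X$ for all $X\in\Delta$; $\Vdash$ is a sequent if $X\in\Gamma$ implies $\Gamma\Vdash X$ and $\Gamma\Vdash\Delta\Vdash X$ implies $\Gamma\Vdash X$. The inference relation $\vdash$ is the smallest sequent such that for all $F,G,P,Q,R,S\in\mathsf{T}$ and $m,n\in\omega$: $\{(R:P),(R\twoheadrightarrow S)\}\vdash(S:P)$; $\{(S:R),(R\triangleright P)\}\vdash(S:P)$; $\{(S:R),(F:\mathsf{p}_m^nRG)\}\vdash(FS:GS)$; and, whenever $\Gamma\vdash(Q:\mathsf{u}_m)$ and $x\in\mathsf{V}\setminus(\mathsf{F}(\Gamma)\cup\mathsf{F}(Q))$, if $\Gamma\cup\{(x:Q)\}\vdash(S:P)$ and $\Gamma\cup\{(x:Q)\}\vdash(P:\mathsf{u}_n)$ then $\Gamma\vdash(\lambda xQS:\pi_m^nxQP)$. -}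

module Defs where

open import Data.Nat using (ℕ; _≟_)
open import Data.Product using (Σ; _×_; _,_)
open import Data.Sum using (_⊎_)
open import Data.Unit using (⊤)
open import Data.Empty using (⊥)
open import Data.Maybe using (Maybe; just; nothing)
open import Relation.Nullary using (¬_; yes; no)
open import Relation.Binary.PropositionalEquality using (_≡_; _≢_)
open import Function.Bundles using (_⇔_)

-- The paper works in (classical) set theory; interpretations assign
-- arbitrary sets.

record SetTheory : Set₁ where
  field
    M      : Set
    _∈_    : M → M → Set
    ext    : ∀ {a b} → (∀ z → (z ∈ a → z ∈ b) × (z ∈ b → z ∈ a)) → a ≡ b
    upair  : M → M → M
    upair-∈ : ∀ a b z → (z ∈ upair a b) ⇔ (z ≡ a ⊎ z ≡ b)
    ⋃      : M → M
    ⋃-∈    : ∀ a z → (z ∈ ⋃ a) ⇔ Σ M (λ y → y ∈ a × z ∈ y)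
    𝒫      : M → M
    𝒫-∈    : ∀ a z → (z ∈ 𝒫 a) ⇔ (∀ w → w ∈ z → w ∈ a)
    sep    : (M → Set) → M → M
    sep-∈  : ∀ P a z → (z ∈ sep P a) ⇔ (z ∈ a × P z)
    repl   : (M → M) → M → M
    repl-∈ : ∀ f a z → (z ∈ repl f a) ⇔ Σ M (λ x → x ∈ a × z ≡ f x)

module SetNotions (T : SetTheory) where
  open SetTheory T

  ⟨_,_⟩ : M → M → M
  ⟨ a , b ⟩ = upair (upair a a) (upair a b)

  _⊆_ : M → M → Set
  a ⊆ b = ∀ z → z ∈ a → z ∈ b

  dom : M → M
  dom R = sep (λ d → Σ M (λ r → ⟨ r , d ⟩ ∈ R)) (⋃ (⋃ R))

  _·_ : M → M → M
  R · s = ⋃ (sep (λ r → ⟨ r , s ⟩ ∈ R) (⋃ (⋃ R)))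

  -- a function F is a set of pairs ⟨F(d),d⟩
  IsFunction : M → Set
  IsFunction F = ∀ z → z ∈ F → Σ M (λ d → z ≡ ⟨ F · d , d ⟩)

  pairsOf : M → M → M
  pairsOf Y X = ⋃ (repl (λ x → repl (λ y → ⟨ y , x ⟩) Y) X)

  _^_ : M → M → M
  Y ^ X = sep (λ F → IsFunction F × (dom F ≡ X) × (∀ d → d ∈ X → (F · d) ∈ Y))
              (𝒫 (pairsOf Y X))

  range : M → M
  range φ = repl (λ d → φ · d) (dom φ)

  ∏ : M → M
  ∏ φ = sep (λ f → IsFunction f × (dom f ≡ dom φ)
                    × (∀ d → d ∈ dom φ → (f · d) ∈ (φ · d)))
            (𝒫 (pairsOf (⋃ (range φ)) (dom φ)))

  graph : M → (M → M) → M
  graph A f = repl (λ r → ⟨ f r , r ⟩) A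

data Const (K : Set) : Set where
  u : ℕ → Const K
  p : ℕ → ℕ → Const K
  k : K → Const K

data Term (K : Set) : Set where
  con : Const K → Term K
  var : ℕ → Term K
  app : Term K → Term K → Term K
  lam : ℕ → Term K → Term K → Term K

π : {K : Set} → ℕ → ℕ → ℕ → Term K → Term K → Term K
π m n x Q P = app (app (con (p m n)) Q) (lam x Q P)

Free : {K : Set} → Term K → ℕ → Set
Free (con a) y = ⊥
Free (var x) y = y ≡ x
Free (app R S) y = Free R y ⊎ Free S y
Free (lam x R S) y = Free R y ⊎ (Free S y × y ≢ x)

data Stmt (K : Set) : Set where
  _∶_ : Term K → Term K → Stmt K
  _↠_ : Term K → Term K → Stmt K
  _▷_ : Term K → Term K → Stmt K

Ctx : Set → Set₁
Ctx K = Stmt K → Set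

｛_,_｝ : {K : Set} → Stmt K → Stmt K → Ctx K
｛ A , B ｝ Y = Y ≡ A ⊎ Y ≡ B

_∪｛_｝ : {K : Set} → Ctx K → Stmt K → Ctx K
(Γ ∪｛ A ｝) Y = Γ Y ⊎ Y ≡ A

FreeCtx : {K : Set} → Ctx K → ℕ → Set
FreeCtx {K} Γ x = Σ (Term K) (λ S → Σ (Term K) (λ P → Γ (S ∶ P) × (Free S x ⊎ Free P x)))

infix 4 _⊢_
data _⊢_ {K : Set} : Ctx K → Stmt K → Set₁ where
  assum : ∀ {Γ X} → Γ X → Γ ⊢ X
  cut   : ∀ {Γ X} (Δ : Ctx K) → (∀ Y → Δ Y → Γ ⊢ Y) → Δ ⊢ X → Γ ⊢ X
  conv  : ∀ {R P S} → ｛ R ∶ P , R ↠ S ｝ ⊢ (S ∶ P)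
  sub   : ∀ {S R P} → ｛ S ∶ R , R ▷ P ｝ ⊢ (S ∶ P)
  apl   : ∀ {S R F G m n} → ｛ S ∶ R , F ∶ app (app (con (p m n)) R) G ｝ ⊢ (app F S ∶ app G S)
  abs   : ∀ {Γ Q S P m n x} → Γ ⊢ (Q ∶ con (u m))
        → ¬ FreeCtx Γ x → ¬ Free Q x
        → (Γ ∪｛ var x ∶ Q ｝) ⊢ (S ∶ P)
        → (Γ ∪｛ var x ∶ Q ｝) ⊢ (P ∶ con (u n))
        → Γ ⊢ (lam x Q S ∶ π m n x Q P)

module Semantics (T : SetTheory) (K : Set) where
  open SetTheory T
  open SetNotions T

  record Interp : Set where
    field
      vars  : ℕ → M
      sorts : ℕ → M
      consts : K → M
  open Interp

  _[_↦_] : (ℕ → M) → ℕ → M → (ℕ → M)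
  (ρ [ x ↦ r ]) y with y ≟ x
  ... | yes _ = r
  ... | no _  = ρ y

  override : (ℕ → M) → (ℕ → Maybe M) → (ℕ → M)
  override ρ ψ y with ψ y
  ... | just r  = r
  ... | nothing = ρ y

  module _ (I : Interp) where
    ⟦p⟧ : ℕ → ℕ → M
    ⟦p⟧ m n = graph (sorts I m) (λ D → graph (sorts I n ^ D) (λ φ → ∏ φ))

    ⟦_⟧_ : Term K → (ℕ → M) → M
    ⟦ con (u n) ⟧ ρ = sorts I n
    ⟦ con (p m n) ⟧ ρ = ⟦p⟧ m n
    ⟦ con (k a) ⟧ ρ = consts I a
    ⟦ var x ⟧ ρ = ρ x
    ⟦ app R S ⟧ ρ = (⟦ R ⟧ ρ) · (⟦ S ⟧ ρ)
    ⟦ lam x R S ⟧ ρ = graph (⟦ R ⟧ ρ) (λ r → ⟦ S ⟧ (ρ [ x ↦ r ]))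

    WF : Term K → (ℕ → M) → Set
    WF (con a) ρ = ⊤
    WF (var x) ρ = ⊤
    WF (app F S) ρ = WF F ρ × WF S ρ × IsFunction (⟦ F ⟧ ρ) × ((⟦ S ⟧ ρ) ∈ dom (⟦ F ⟧ ρ))
    WF (lam x R S) ρ = WF R ρ × (∀ r → r ∈ (⟦ R ⟧ ρ) → WF S (ρ [ x ↦ r ]))

    Sat : Stmt K → Set
    Sat (S ∶ P) = WF S (vars I) × WF P (vars I) × ((⟦ S ⟧ vars I) ∈ (⟦ P ⟧ vars I))
    Sat (R ↠ C) = ∀ (ψ : ℕ → Maybe M) → let ρ = override (vars I) ψ in
                    WF R ρ → WF C ρ × (⟦ R ⟧ ρ ≡ ⟦ C ⟧ ρ)
    Sat (R ▷ C) = ∀ (ψ : ℕ → Maybe M) → let ρ = override (vars I) ψ in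
                    WF R ρ → WF C ρ × ((⟦ R ⟧ ρ) ⊆ (⟦ C ⟧ ρ))

  _⊨_ : Ctx K → Stmt K → Set
  Γ ⊨ X = ∀ (I : Interp) → (∀ Y → Γ Y → Sat I Y) → Sat I X

{-# OPTIONS --safe #-}
-- Conversion and sub-reduction are immediate because a
-- reduction statement holds under every valuation.  Application and
-- abstraction are elimination and introduction for the dependent product that
-- ⟦p_m^n⟧ encodes: ⟦p_m^n⟧ D φ is ∏ φ, and ⟦λxQS⟧ is the graph of
-- r ↦ ⟦S⟧[x:=r] on ⟦Q⟧.  For abstraction the premises are read in the
-- interpretation updated at x := r for each r ∈ ⟦Q⟧; by the coincidence lemma
-- (meaning and well-formedness of a term depend only on its free variables)
-- the freshness of x keeps Γ satisfied there.
module Submission where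

open import Defs
open import Data.Nat using (ℕ; _≟_)
open import Data.Product using (Σ; _×_; _,_; proj₁; proj₂)
open import Data.Sum using (_⊎_; inj₁; inj₂; reduce)
open import Data.Unit using (tt)
open import Data.Empty using (⊥; ⊥-elim)
open import Data.Maybe using (just)
open import Function.Base using (_∘_; _∘₂_)
open import Function.Bundles using (Equivalence)
open import Relation.Nullary using (¬_; yes; no)
open import Relation.Binary.PropositionalEquality
  using (_≡_; _≢_; refl; sym; trans; cong; cong₂; subst; subst₂)

module SetNotionProperties (T : SetTheory) where
  open SetTheory T
  open SetNotions T
  open Equivalence using (to; from)

  ⊆-antisym : ∀ {a b} → a ⊆ b → b ⊆ a → a ≡ b
  ⊆-antisym a⊆b b⊆a = ext λ z → a⊆b z , b⊆a z

  ∈-upairˡ : ∀ a b → a ∈ upair a b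
  ∈-upairˡ a b = from (upair-∈ a b a) (inj₁ refl)

  ∈-upairʳ : ∀ a b → b ∈ upair a b
  ∈-upairʳ a b = from (upair-∈ a b b) (inj₂ refl)

  ∈-upair⁻ : ∀ {a b z} → z ∈ upair a b → z ≡ a ⊎ z ≡ b
  ∈-upair⁻ {a} {b} {z} = to (upair-∈ a b z)

  ∈-singleton⁻ : ∀ {a z} → z ∈ upair a a → z ≡ a
  ∈-singleton⁻ = reduce ∘ ∈-upair⁻

  upair-cancelˡ : ∀ {a b d} → upair a b ≡ upair a d → b ≡ d
  upair-cancelˡ {a} {b} {d} e with ∈-upair⁻ (subst (b ∈_) e (∈-upairʳ a b))
  ... | inj₂ b≡d = b≡d
  ... | inj₁ b≡a with ∈-upair⁻ (subst (d ∈_) (sym e) (∈-upairʳ a d))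
  ...   | inj₁ d≡a = trans b≡a (sym d≡a)
  ...   | inj₂ d≡b = sym d≡b

  -- {a} is {c} or {c,d}, and both contain c.
  ⟨,⟩-injectiveˡ : ∀ {a b c d} → ⟨ a , b ⟩ ≡ ⟨ c , d ⟩ → a ≡ c
  ⟨,⟩-injectiveˡ {a} {b} {c} {d} e =
    sym (∈-singleton⁻ (c∈ (∈-upair⁻ (subst (upair a a ∈_) e (∈-upairˡ _ _)))))
    where
    c∈ : upair a a ≡ upair c c ⊎ upair a a ≡ upair c d → c ∈ upair a a
    c∈ (inj₁ e₁) = subst (c ∈_) (sym e₁) (∈-upairˡ c c)
    c∈ (inj₂ e₂) = subst (c ∈_) (sym e₂) (∈-upairˡ c d)

  ⟨,⟩-injectiveʳ : ∀ {a b c d} → ⟨ a , b ⟩ ≡ ⟨ c , d ⟩ → b ≡ d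
  ⟨,⟩-injectiveʳ e with ⟨,⟩-injectiveˡ e
  ... | refl = upair-cancelˡ (upair-cancelˡ e)

  ⋃-singleton : ∀ a → ⋃ (upair a a) ≡ a
  ⋃-singleton a = ⊆-antisym
    (λ z z∈⋃ → let (y , y∈ , z∈y) = to (⋃-∈ _ z) z∈⋃ in subst (z ∈_) (∈-singleton⁻ y∈) z∈y)
    (λ z z∈a → from (⋃-∈ _ z) (a , ∈-upairˡ a a , z∈a))

  ∈⋃⋃-fst : ∀ {a b R} → ⟨ a , b ⟩ ∈ R → a ∈ ⋃ (⋃ R)
  ∈⋃⋃-fst {a} {b} {R} h =
    from (⋃-∈ _ a) (upair a a , from (⋃-∈ R _) (_ , h , ∈-upairˡ _ _) , ∈-upairˡ a a)

  ∈⋃⋃-snd : ∀ {a b R} → ⟨ a , b ⟩ ∈ R → b ∈ ⋃ (⋃ R)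
  ∈⋃⋃-snd {a} {b} {R} h =
    from (⋃-∈ _ b) (upair a b , from (⋃-∈ R _) (_ , h , ∈-upairʳ _ _) , ∈-upairʳ a b)

  ∈-dom : ∀ {R r d} → ⟨ r , d ⟩ ∈ R → d ∈ dom R
  ∈-dom {r = r} h = from (sep-∈ _ _ _) (∈⋃⋃-snd h , r , h)

  ∈-dom⁻ : ∀ {R d} → d ∈ dom R → Σ M (λ r → ⟨ r , d ⟩ ∈ R)
  ∈-dom⁻ = proj₂ ∘ to (sep-∈ _ _ _)

  ·-unique : ∀ {R d y} → ⟨ y , d ⟩ ∈ R → (∀ z → ⟨ z , d ⟩ ∈ R → z ≡ y) → R · d ≡ y
  ·-unique {R} {d} {y} h unique = trans (cong ⋃ values≡) (⋃-singleton y)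
    where
    values≡ : sep (λ r → ⟨ r , d ⟩ ∈ R) (⋃ (⋃ R)) ≡ upair y y
    values≡ = ⊆-antisym
      (λ z z∈ → subst (_∈ upair y y) (sym (unique z (proj₂ (to (sep-∈ _ _ z) z∈)))) (∈-upairˡ y y))
      (λ z z∈ → subst (_∈ _) (sym (∈-singleton⁻ z∈)) (from (sep-∈ _ _ y) (∈⋃⋃-fst h , h)))

  ∈-graph : ∀ {A f d} → d ∈ A → ⟨ f d , d ⟩ ∈ graph A f
  ∈-graph {d = d} d∈A = from (repl-∈ _ _ _) (d , d∈A , refl)

  ∈-graph⁻ : ∀ {A f z d} → ⟨ z , d ⟩ ∈ graph A f → d ∈ A × z ≡ f d
  ∈-graph⁻ h with to (repl-∈ _ _ _) h
  ... | x , x∈A , e with ⟨,⟩-injectiveʳ e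
  ... | refl = x∈A , ⟨,⟩-injectiveˡ e

  graph-· : ∀ {A f d} → d ∈ A → graph A f · d ≡ f d
  graph-· d∈A = ·-unique (∈-graph d∈A) (λ _ → proj₂ ∘ ∈-graph⁻)

  graph-isFunction : ∀ {A f} → IsFunction (graph A f)
  graph-isFunction z z∈ with to (repl-∈ _ _ z) z∈
  ... | x , x∈A , refl = x , cong (λ w → ⟨ w , x ⟩) (sym (graph-· x∈A))

  dom-graph : ∀ {A f} → dom (graph A f) ≡ A
  dom-graph = ⊆-antisym (λ _ → proj₁ ∘ ∈-graph⁻ ∘ proj₂ ∘ ∈-dom⁻) (λ _ → ∈-dom ∘ ∈-graph)

  graph-∈-𝒫-pairsOf : ∀ {A f Y} → (∀ d → d ∈ A → f d ∈ Y) → graph A f ∈ 𝒫 (pairsOf Y A)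
  graph-∈-𝒫-pairsOf {A} {f} {Y} f∈Y = from (𝒫-∈ _ _) λ w w∈ → pair∈ w (to (repl-∈ _ A w) w∈)
    where
    pair∈ : ∀ w → Σ M (λ x → x ∈ A × w ≡ ⟨ f x , x ⟩) → w ∈ pairsOf Y A
    pair∈ w (x , x∈A , e) = from (⋃-∈ _ w)
      ( repl (λ y → ⟨ y , x ⟩) Y
      , from (repl-∈ _ A _) (x , x∈A , refl)
      , from (repl-∈ _ Y w) (f x , f∈Y x x∈A , e))

  graph-∈-^ : ∀ {A f Y} → (∀ d → d ∈ A → f d ∈ Y) → graph A f ∈ (Y ^ A)
  graph-∈-^ {Y = Y} f∈Y = from (sep-∈ _ _ _)
    ( graph-∈-𝒫-pairsOf f∈Y , graph-isFunction , dom-graph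
    , λ d d∈A → subst (_∈ Y) (sym (graph-· d∈A)) (f∈Y d d∈A))

  ^-∈⁻ : ∀ {F Y X} → F ∈ (Y ^ X) → IsFunction F × (dom F ≡ X) × (∀ d → d ∈ X → (F · d) ∈ Y)
  ^-∈⁻ = proj₂ ∘ to (sep-∈ _ _ _)

  graph-∈-∏ : ∀ {A f φ} → (∀ d → d ∈ A → f d ∈ φ d) → graph A f ∈ ∏ (graph A φ)
  graph-∈-∏ {A} {f} {φ} f∈φ = from (sep-∈ _ _ _)
    ( subst (λ X → graph A f ∈ 𝒫 (pairsOf (⋃ (range (graph A φ))) X)) (sym dom-graph)
        (graph-∈-𝒫-pairsOf f∈⋃range)
    , graph-isFunction
    , trans dom-graph (sym dom-graph)
    , λ d d∈dom → let d∈A = subst (d ∈_) dom-graph d∈dom in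
        subst₂ _∈_ (sym (graph-· d∈A)) (sym (graph-· d∈A)) (f∈φ d d∈A))
    where
    f∈⋃range : ∀ d → d ∈ A → f d ∈ ⋃ (range (graph A φ))
    f∈⋃range d d∈A = from (⋃-∈ _ _)
      ( φ d
      , from (repl-∈ _ _ _) (d , subst (d ∈_) (sym dom-graph) d∈A , sym (graph-· d∈A))
      , f∈φ d d∈A)

  ∏-∈⁻ : ∀ {f φ} → f ∈ ∏ φ → IsFunction f × (dom f ≡ dom φ) × (∀ d → d ∈ dom φ → (f · d) ∈ (φ · d))
  ∏-∈⁻ = proj₂ ∘ to (sep-∈ _ _ _)

  graph-cong : ∀ {A B f g} → A ≡ B → (∀ r → f r ≡ g r) → graph A f ≡ graph B g
  graph-cong {A} refl f≗g = ⊆-antisym (into f≗g) (into (sym ∘ f≗g))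
    where
    into : ∀ {f g} → (∀ r → f r ≡ g r) → graph A f ⊆ graph A g
    into {f} {g} f≗g z z∈ with to (repl-∈ _ A z) z∈
    ... | x , x∈A , refl = subst (_∈ graph A g) (cong (λ w → ⟨ w , x ⟩) (sym (f≗g x))) (∈-graph x∈A)

  -- ⟦p_m^n⟧ is definitionally Pi ⟦u_m⟧ ⟦u_n⟧.
  Pi : M → M → M
  Pi A B = graph A (λ D → graph (B ^ D) ∏)

  Applicable : M → M → Set
  Applicable F s = IsFunction F × s ∈ dom F

  Pi-· : ∀ {A B D} → D ∈ A → Pi A B · D ≡ graph (B ^ D) ∏
  Pi-· = graph-·

  Pi-·-· : ∀ {A B D G} → D ∈ A → G ∈ (B ^ D) → (Pi A B · D) · G ≡ ∏ G
  Pi-·-· D∈A G∈ = trans (cong (_· _) (Pi-· D∈A)) (graph-· G∈)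

  Pi-intro : ∀ {A B D f φ} → D ∈ A → (∀ r → r ∈ D → φ r ∈ B) → (∀ r → r ∈ D → f r ∈ φ r)
           → Applicable (Pi A B) D × Applicable (Pi A B · D) (graph D φ)
             × graph D f ∈ ((Pi A B · D) · graph D φ)
  Pi-intro {A} {B} {D} {f} {φ} D∈A φ∈B f∈φ =
    (graph-isFunction , ∈-dom (∈-graph D∈A))
    , ( subst IsFunction (sym (Pi-· D∈A)) graph-isFunction
      , subst (λ F → graph D φ ∈ dom F) (sym (Pi-· D∈A)) (∈-dom (∈-graph φ∈B^D)))
    , subst (graph D f ∈_) (sym (Pi-·-· D∈A φ∈B^D)) (graph-∈-∏ f∈φ)
    where
    φ∈B^D : graph D φ ∈ (B ^ D)
    φ∈B^D = graph-∈-^ φ∈B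

  Pi-elim : ∀ {A B D G F s} → D ∈ dom (Pi A B) → G ∈ dom (Pi A B · D) → F ∈ ((Pi A B · D) · G)
          → s ∈ D → Applicable F s × Applicable G s × (F · s) ∈ (G · s)
  Pi-elim {A} {B} {D} {G} {F} {s} D∈dom G∈dom F∈ s∈D =
    let (G-fun , domG≡D , _) = ^-∈⁻ G∈B^D
        (F-fun , domF≡domG , F∈G) = ∏-∈⁻ (subst (F ∈_) (Pi-·-· D∈A G∈B^D) F∈)
        s∈domG = subst (s ∈_) (sym domG≡D) s∈D
    in (F-fun , subst (s ∈_) (sym domF≡domG) s∈domG) , (G-fun , s∈domG) , F∈G s s∈domG
    where
    D∈A : D ∈ A
    D∈A = subst (D ∈_) dom-graph D∈dom
    G∈B^D : G ∈ (B ^ D)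
    G∈B^D = subst (G ∈_) dom-graph (subst (λ P → G ∈ dom P) (Pi-· D∈A) G∈dom)

module Soundness (T : SetTheory) (K : Set) where
  open SetTheory T
  open SetNotions T
  open SetNotionProperties T
  open Semantics T K
  open Interp

  [↦]-≡ : ∀ (ρ : ℕ → M) x r → (ρ [ x ↦ r ]) x ≡ r
  [↦]-≡ ρ x r with x ≟ x
  ... | yes _ = refl
  ... | no x≢x = ⊥-elim (x≢x refl)

  [↦]-≢ : ∀ (ρ : ℕ → M) x r {y} → y ≢ x → ρ y ≡ (ρ [ x ↦ r ]) y
  [↦]-≢ ρ x r {y} y≢x with y ≟ x
  ... | yes y≡x = ⊥-elim (y≢x y≡x)
  ... | no _ = refl

  Agree : Term K → (ℕ → M) → (ℕ → M) → Set
  Agree t ρ σ = ∀ y → Free t y → ρ y ≡ σ y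

  Agree-refl : ∀ {t ρ} → Agree t ρ ρ
  Agree-refl _ _ = refl

  Agree-lam : ∀ {x R S ρ σ} r → Agree (lam x R S) ρ σ → Agree S (ρ [ x ↦ r ]) (σ [ x ↦ r ])
  Agree-lam {x} r ρ≈σ y y∈S with y ≟ x
  ... | yes _ = refl
  ... | no y≢x = ρ≈σ y (inj₂ (y∈S , y≢x))

  Agree-fresh : ∀ {t x ρ} r → ¬ Free t x → Agree t ρ (ρ [ x ↦ r ])
  Agree-fresh {ρ = ρ} r x∉t y y∈t = [↦]-≢ ρ _ r λ { refl → x∉t y∈t }

  record SameConstants (I J : Interp) : Set where
    field
      sorts-≡  : ∀ n → sorts I n ≡ sorts J n
      consts-≡ : ∀ a → consts I a ≡ consts J a
  open SameConstants

  SameConstants-sym : ∀ {I J} → SameConstants I J → SameConstants J I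
  SameConstants-sym c = record { sorts-≡ = sym ∘ sorts-≡ c ; consts-≡ = sym ∘ consts-≡ c }

  withVar : Interp → ℕ → M → Interp
  withVar I x r = record I { vars = vars I [ x ↦ r ] }

  SameConstants-withVar : ∀ {I x r} → SameConstants I (withVar I x r)
  SameConstants-withVar = record { sorts-≡ = λ _ → refl ; consts-≡ = λ _ → refl }

  ⟦⟧-coincide : ∀ {I J} → SameConstants I J → ∀ t {ρ σ} → Agree t ρ σ → ⟦_⟧_ I t ρ ≡ ⟦_⟧_ J t σ
  ⟦⟧-coincide c (con (u n))   _   = sorts-≡ c n
  ⟦⟧-coincide c (con (p m n)) _   = cong₂ Pi (sorts-≡ c m) (sorts-≡ c n)
  ⟦⟧-coincide c (con (k a))   _   = consts-≡ c a
  ⟦⟧-coincide c (var x)       ρ≈σ = ρ≈σ x refl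
  ⟦⟧-coincide c (app R S)     ρ≈σ =
    cong₂ _·_ (⟦⟧-coincide c R (λ y → ρ≈σ y ∘ inj₁)) (⟦⟧-coincide c S (λ y → ρ≈σ y ∘ inj₂))
  ⟦⟧-coincide c (lam x R S)   ρ≈σ =
    graph-cong (⟦⟧-coincide c R (λ y → ρ≈σ y ∘ inj₁)) (λ r → ⟦⟧-coincide c S (Agree-lam r ρ≈σ))

  WF-coincide : ∀ {I J} → SameConstants I J → ∀ t {ρ σ} → Agree t ρ σ → WF I t ρ → WF J t σ
  WF-coincide c (con a) _ _ = tt
  WF-coincide c (var x) _ _ = tt
  WF-coincide {I} {J} c (app F S) {ρ} {σ} ρ≈σ (wF , wS , F-fun , S∈domF) =
    WF-coincide c F ρ≈F wF , WF-coincide c S ρ≈S wS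
    , subst IsFunction F≡ F-fun , subst₂ (λ s f → s ∈ dom f) (⟦⟧-coincide c S ρ≈S) F≡ S∈domF
    where
    ρ≈F : Agree F ρ σ
    ρ≈F y = ρ≈σ y ∘ inj₁
    ρ≈S : Agree S ρ σ
    ρ≈S y = ρ≈σ y ∘ inj₂
    F≡ : ⟦_⟧_ I F ρ ≡ ⟦_⟧_ J F σ
    F≡ = ⟦⟧-coincide c F ρ≈F
  WF-coincide c (lam x R S) {ρ} {σ} ρ≈σ (wR , wS) =
    WF-coincide c R ρ≈R wR
    , λ r r∈R → WF-coincide c S (Agree-lam r ρ≈σ)
                  (wS r (subst (r ∈_) (sym (⟦⟧-coincide c R ρ≈R)) r∈R))
    where
    ρ≈R : Agree R ρ σ
    ρ≈R y = ρ≈σ y ∘ inj₁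

  Typed : Interp → (ℕ → M) → Term K → Term K → Set
  Typed I ρ S P = WF I S ρ × WF I P ρ × ⟦_⟧_ I S ρ ∈ ⟦_⟧_ I P ρ

  Typed-coincide : ∀ {I J S P ρ σ} → SameConstants I J → Agree S ρ σ → Agree P ρ σ
                 → Typed I ρ S P → Typed J σ S P
  Typed-coincide {S = S} {P} c ρ≈S ρ≈P (wS , wP , S∈P) =
    WF-coincide c S ρ≈S wS , WF-coincide c P ρ≈P wP
    , subst₂ _∈_ (⟦⟧-coincide c S ρ≈S) (⟦⟧-coincide c P ρ≈P) S∈P

  Valid : Interp → (M → M → Set) → Term K → Term K → Set
  Valid I _~_ R C = ∀ σ → WF I R σ → WF I C σ × (⟦_⟧_ I R σ ~ ⟦_⟧_ I C σ)

  -- Overriding by  just ∘ σ  replaces the whole assignment, so a reduction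
  -- statement holds under every valuation and does not depend on  vars I.
  Sat-↠⇒Valid : ∀ {I R C} → Sat I (R ↠ C) → Valid I _≡_ R C
  Sat-↠⇒Valid R↠C σ = R↠C (just ∘ σ)

  Sat-▷⇒Valid : ∀ {I R C} → Sat I (R ▷ C) → Valid I _⊆_ R C
  Sat-▷⇒Valid R▷C σ = R▷C (just ∘ σ)

  Valid-coincide : ∀ {I J _~_ R C} → SameConstants I J → Valid I _~_ R C → Valid J _~_ R C
  Valid-coincide {_~_ = _~_} {R} {C} c valid σ wR =
    let (wC , R~C) = valid σ (WF-coincide (SameConstants-sym c) R Agree-refl wR)
    in WF-coincide c C Agree-refl wC
       , subst₂ _~_ (⟦⟧-coincide c R Agree-refl) (⟦⟧-coincide c C Agree-refl) R~C

  FreeStmt : Stmt K → ℕ → Set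
  FreeStmt (S ∶ P) y = Free S y ⊎ Free P y
  FreeStmt (R ↠ C) y = ⊥
  FreeStmt (R ▷ C) y = ⊥

  FreeStmt⇒FreeCtx : ∀ {Γ Y y} → Γ Y → FreeStmt Y y → FreeCtx Γ y
  FreeStmt⇒FreeCtx {Y = S ∶ P} ΓY y∈Y = S , P , ΓY , y∈Y

  Sat-coincide : ∀ {I J} → SameConstants I J → ∀ Y → (∀ y → FreeStmt Y y → vars I y ≡ vars J y)
               → Sat I Y → Sat J Y
  Sat-coincide c (S ∶ P) I≈J = Typed-coincide c (λ y → I≈J y ∘ inj₁) (λ y → I≈J y ∘ inj₂)
  Sat-coincide c (R ↠ C) _ R↠C _ = Valid-coincide {_~_ = _≡_} c (Sat-↠⇒Valid R↠C) _
  Sat-coincide c (R ▷ C) _ R▷C _ = Valid-coincide {_~_ = _⊆_} c (Sat-▷⇒Valid R▷C) _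

  Sat-withVar : ∀ {Γ Q x} I r → ¬ FreeCtx Γ x → ¬ Free Q x
              → (∀ Y → Γ Y → Sat I Y) → WF I Q (vars I) → r ∈ ⟦_⟧_ I Q (vars I)
              → ∀ Y → (Γ ∪｛ var x ∶ Q ｝) Y → Sat (withVar I x r) Y
  Sat-withVar {Γ} I r x∉Γ _ ⊨Γ _ _ Y (inj₁ ΓY) =
    Sat-coincide SameConstants-withVar Y
      (λ y y∈Y → [↦]-≢ (vars I) _ r λ { refl → x∉Γ (FreeStmt⇒FreeCtx {Γ} ΓY y∈Y) })
      (⊨Γ Y ΓY)
  Sat-withVar {Q = Q} {x} I r _ x∉Q _ wQ r∈Q _ (inj₂ refl) =
    tt , WF-coincide SameConstants-withVar Q (Agree-fresh r x∉Q) wQ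
    , subst₂ _∈_ (sym ([↦]-≡ (vars I) x r))
                 (⟦⟧-coincide SameConstants-withVar Q (Agree-fresh r x∉Q)) r∈Q

  ⊨-conv : ∀ {R P S} → ｛ R ∶ P , R ↠ S ｝ ⊨ (S ∶ P)
  ⊨-conv I ⊨Γ with ⊨Γ _ (inj₁ refl) | ⊨Γ _ (inj₂ refl)
  ... | wR , wP , R∈P | R↠S with Sat-↠⇒Valid R↠S (vars I) wR
  ...   | wS , R≡S = wS , wP , subst (_∈ _) R≡S R∈P

  ⊨-sub : ∀ {S R P} → ｛ S ∶ R , R ▷ P ｝ ⊨ (S ∶ P)
  ⊨-sub I ⊨Γ with ⊨Γ _ (inj₁ refl) | ⊨Γ _ (inj₂ refl)
  ... | wS , wR , S∈R | R▷P with Sat-▷⇒Valid R▷P (vars I) wR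
  ...   | wP , R⊆P = wS , wP , R⊆P _ S∈R

  ⊨-apl : ∀ {S R F G m n} → ｛ S ∶ R , F ∶ app (app (con (p m n)) R) G ｝ ⊨ (app F S ∶ app G S)
  ⊨-apl I ⊨Γ with ⊨Γ _ (inj₁ refl) | ⊨Γ _ (inj₂ refl)
  ... | wS , _ , S∈R | wF , ((_ , _ , _ , R∈dom) , wG , _ , G∈dom) , F∈ =
    let (F-app , G-app , FS∈GS) = Pi-elim R∈dom G∈dom F∈ S∈R
    in (wF , wS , F-app) , (wG , wS , G-app) , FS∈GS

  ⊨-abs : ∀ {Γ Q S P m n x} → Γ ⊨ (Q ∶ con (u m)) → ¬ FreeCtx Γ x → ¬ Free Q x
        → (Γ ∪｛ var x ∶ Q ｝) ⊨ (S ∶ P) → (Γ ∪｛ var x ∶ Q ｝) ⊨ (P ∶ con (u n))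
        → Γ ⊨ (lam x Q S ∶ π m n x Q P)
  ⊨-abs {Γ} {Q} {S} {P} {m} {n} {x} ⊨Q x∉Γ x∉Q ⊨S ⊨P I ⊨Γ =
    let (Pi-app , PiQ-app , lam∈) = Pi-intro {f = ⟦S⟧} {φ = ⟦P⟧} Q∈u
          (λ r r∈Q → proj₂ (proj₂ (P∶u r r∈Q))) (λ r r∈Q → proj₂ (proj₂ (S∶P r r∈Q)))
    in (wQ , proj₁ ∘₂ S∶P) , ((tt , wQ , Pi-app) , (wQ , proj₁ ∘₂ P∶u) , PiQ-app) , lam∈
    where
    ρ : ℕ → M
    ρ = vars I
    wQ : WF I Q ρ
    wQ = proj₁ (⊨Q I ⊨Γ)
    Q∈u : ⟦_⟧_ I Q ρ ∈ sorts I m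
    Q∈u = proj₂ (proj₂ (⊨Q I ⊨Γ))
    ⟦S⟧ ⟦P⟧ : M → M
    ⟦S⟧ r = ⟦_⟧_ I S (ρ [ x ↦ r ])
    ⟦P⟧ r = ⟦_⟧_ I P (ρ [ x ↦ r ])
    at : ∀ {A B} → (Γ ∪｛ var x ∶ Q ｝) ⊨ (A ∶ B) → ∀ r → r ∈ ⟦_⟧_ I Q ρ → Typed I (ρ [ x ↦ r ]) A B
    at ⊨A r r∈Q = Typed-coincide (SameConstants-sym SameConstants-withVar) Agree-refl Agree-refl
                    (⊨A (withVar I x r) (Sat-withVar I r x∉Γ x∉Q ⊨Γ wQ r∈Q))
    S∶P : ∀ r → r ∈ ⟦_⟧_ I Q ρ → Typed I (ρ [ x ↦ r ]) S P
    S∶P = at {S} {P} ⊨S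
    P∶u : ∀ r → r ∈ ⟦_⟧_ I Q ρ → Typed I (ρ [ x ↦ r ]) P (con (u n))
    P∶u = at {P} {con (u n)} ⊨P

proposition14p7 : (T : SetTheory) (K : Set) (Γ : Ctx K) (X : Stmt K)
    → Γ ⊢ X → Semantics._⊨_ T K Γ X
proposition14p7 T K _ _ = sound
  where
  open Semantics T K using (_⊨_)
  open Soundness T K
  sound : ∀ {Γ X} → Γ ⊢ X → Γ ⊨ X
  sound (assum ΓX)             I ⊨Γ = ⊨Γ _ ΓX
  sound (cut Δ Γ⊢Δ Δ⊢X)        I ⊨Γ = sound Δ⊢X I (λ Y ΔY → sound (Γ⊢Δ Y ΔY) I ⊨Γ)
  sound conv                        = ⊨-conv
  sound sub                         = ⊨-sub
  sound apl                         = ⊨-apl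
  sound (abs ⊢Q x∉Γ x∉Q ⊢S ⊢P)      = ⊨-abs (sound ⊢Q) x∉Γ x∉Q (sound ⊢S) (sound ⊢P)
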